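{- Let $(S,B)$ be a Kleenean W-monoid whose underlying restriction monoid with tests is functional. Then for all $s,t\in S$ and $\alpha\in B$, $((t,\alpha):s)$ is the smallest element $u\in S$ (in the natural order) such that $D(t\alpha)su=D(t\alpha)u$ and $D(t\alpha')u=D(t\alpha')$.
   Context: A monoid with tests is a pair $(S,B)$ with $S$ a monoid with identity $1$ and zero $0$, and $B\subseteq S$ a commutative submonoid of idempotents containing $0$ with unary $'$ making $(B,\cdot,{}',0,1)$ a Boolean algebra with meet the multiplication. A restriction monoid with tests is such a pair with unary $D$ on $S$ such that for all $s,t,u\in S$, $\alpha,\beta\in B$: $D(s)s=s$; $D(st)=D(s)D(st)$; $D(s)D(t)=D(t)D(s)$; $D(D(s))=D(s)$; $sD(t)=D(st)s$; $D(\alpha)=\alpha$; $D(s\beta)t=D(s\beta)u$ and $D(s\beta')t=D(s\beta')u$ imply $D(s)t=D(s)u$. It is functional if $S$ is a submonoid of the monoid $\mathcal P(X)$ of partial functions on a set $X$ (composed left to right), containing the empty map and closed under $D$ ($D(f)$ = identity restricted to $\mathrm{dom} f$), and $B$ is a Boolean subalgebra of the restrictions of the identity. The natural order is $s\le t$ iff $s=D(s)t$. An extended if-then-else monoid is a restriction monoid with tests with an operation $(s,\alpha)[t,u]$ ($s,t,u\in S,\alpha\in B$) satisfying $D(s\alpha)(s,\alpha)[t,u]=D(s\alpha)t$, $D(s\alpha')(s,\alpha)[t,u]=D(s\alpha')u$, $D((s,\alpha)[t,u])\le D(s)$. A W-monoid is an extended if-then-else monoid with an operation $S\times B\times S\to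 S$, $(t,\alpha,s)\mapsto((t,\alpha):s)$, satisfying $((t,\alpha):s)=(t,\alpha)[s((t,\alpha):s),1]$. It is Kleenean if for all $s,t,u\in S$, $\alpha\in B$: $((t,\alpha):s)D(t\alpha')=((t,\alpha):s)$, and $D(t\alpha)su\le u$ implies $((t,\alpha):s)u\le u$. -}

module Defs where

open import Data.Maybe using (Maybe; just; nothing)
open import Data.Product using (_×_)
open import Relation.Binary.PropositionalEquality using (_≡_)

PF : Set → Set
PF X = X → Maybe X

module _ {X : Set} where

  idPF : PF X
  idPF x = just x

  emptyPF : PF X
  emptyPF _ = nothing

  -- composition, left to right: (f ⨾ g)(x) = g(f(x))
  infixl 7 _⨾_
  _⨾_ : PF X → PF X → PF X
  (f ⨾ g) x with f x
  ... | just y  = g y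
  ... | nothing = nothing

  D : PF X → PF X
  D f x with f x
  ... | just _  = just x
  ... | nothing = nothing

  _′ : PF X → PF X
  (a ′) x with a x
  ... | just _  = nothing
  ... | nothing = just x

  infix 4 _≐_
  _≐_ : PF X → PF X → Set
  f ≐ g = ∀ x → f x ≡ g x

  IsRestrictionOfId : PF X → Set
  IsRestrictionOfId f = ∀ x y → f x ≡ just y → y ≡ x

  infix 4 _≤ₙ_
  _≤ₙ_ : PF X → PF X → Set
  s ≤ₙ t = s ≐ D s ⨾ t

-- The restriction
-- structure D is the domain-restriction operation (forced by functionality).
record FunctionalKleeneanWMonoid (X : Set) : Set₁ where
  field
    S : PF X → Set
    B : PF X → Set
    S-id    : S idPF
    S-empty : S emptyPF
    S-comp  : ∀ {f g} → S f → S g → S (f ⨾ g)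
    S-D     : ∀ {f} → S f → S (D f)
    B⊆S     : ∀ {a} → B a → S a
    B-restr : ∀ {a} → B a → IsRestrictionOfId a
    B-one   : B idPF
    B-zero  : B emptyPF
    B-meet  : ∀ {a b} → B a → B b → B (a ⨾ b)
    B-compl : ∀ {a} → B a → B (a ′)
    ite      : PF X → PF X → PF X → PF X → PF X
    S-ite    : ∀ {s α t u} → S s → B α → S t → S u → S (ite s α t u)
    ite-then : ∀ {s α t u} → S s → B α → S t → S u →
               D (s ⨾ α) ⨾ ite s α t u ≐ D (s ⨾ α) ⨾ t
    ite-else : ∀ {s α t u} → S s → B α → S t → S u →
               D (s ⨾ (α ′)) ⨾ ite s α t u ≐ D (s ⨾ (α ′)) ⨾ u
    ite-dom  : ∀ {s α t u} → S s → B α → S t → S u →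
               D (ite s α t u) ≤ₙ D s
    while    : PF X → PF X → PF X → PF X
    S-while  : ∀ {t α s} → S t → B α → S s → S (while t α s)
    while-unfold : ∀ {t α s} → S t → B α → S s →
               while t α s ≐ ite t α (s ⨾ while t α s) idPF
    while-exit : ∀ {t α s} → S t → B α → S s →
               while t α s ⨾ D (t ⨾ (α ′)) ≐ while t α s
    while-ind  : ∀ {t α s u} → S t → B α → S s → S u →
               D (t ⨾ α) ⨾ s ⨾ u ≤ₙ u → while t α s ⨾ u ≤ₙ u

-- The unfolding ((t,α):s) = (t,α)[s((t,α):s), 1] yields both fixpoint equations
-- by restricting to D(tα) and D(tα′).  For leastness, let u satisfy them.
-- Since D(tα)su = D(tα)u ≤ u, the Kleenean induction axiom gives
-- ((t,α):s)u ≤ u; and since every run of the loop exits through D(tα′),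
-- where u acts as the identity, ((t,α):s)u = ((t,α):s).
module Submission where

open import Defs
open import Data.Product using (_×_; _,_)
open import Data.Maybe using (just; nothing)
open import Level using (0ℓ)
open import Relation.Binary.Bundles using (Setoid)
open import Relation.Binary.PropositionalEquality using (refl; sym; trans)
import Relation.Binary.Reasoning.Setoid as SetoidReasoning

≐-setoid : Set → Setoid 0ℓ 0ℓ
≐-setoid X = record
  { Carrier       = PF X
  ; _≈_           = _≐_
  ; isEquivalence = record
    { refl  = λ _ → refl
    ; sym   = λ p x → sym (p x)
    ; trans = λ p q x → trans (p x) (q x)
    }
  }

module _ {X : Set} where

  open Setoid (≐-setoid X) public
    using () renaming (sym to ≐-sym)

  ⨾-assoc : (f g h : PF X) → (f ⨾ g) ⨾ h ≐ f ⨾ (g ⨾ h)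
  ⨾-assoc f g h x with f x
  ... | just _  = refl
  ... | nothing = refl

  ⨾-congˡ : (f : PF X) {g h : PF X} → g ≐ h → f ⨾ g ≐ f ⨾ h
  ⨾-congˡ f p x with f x
  ... | just y  = p y
  ... | nothing = refl

  ⨾-congʳ : {f g : PF X} (h : PF X) → f ≐ g → f ⨾ h ≐ g ⨾ h
  ⨾-congʳ h p x rewrite p x = refl

  ⨾-identityʳ : (f : PF X) → f ⨾ idPF ≐ f
  ⨾-identityʳ f x with f x
  ... | just _  = refl
  ... | nothing = refl

  D-cong : {f g : PF X} → f ≐ g → D f ≐ D g
  D-cong p x rewrite p x = refl

  D⨾-≤ₙ : (c u : PF X) → D c ⨾ u ≤ₙ u
  D⨾-≤ₙ c u x with c x
  ... | nothing = refl
  ... | just _ with u x in eq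
  ...   | just _  rewrite eq = refl
  ...   | nothing = refl

  ≤ₙ-respˡ-≐ : {f g u : PF X} → f ≐ g → g ≤ₙ u → f ≤ₙ u
  ≤ₙ-respˡ-≐ {f} {g} {u} f≐g g≤u = begin
    f           ≈⟨ f≐g ⟩
    g           ≈⟨ g≤u ⟩
    D g ⨾ u     ≈⟨ ⨾-congʳ u (D-cong (≐-sym f≐g)) ⟩
    D f ⨾ u     ∎
    where open SetoidReasoning (≐-setoid X)

module WhileLoop {X : Set} (M : FunctionalKleeneanWMonoid X)
  {s t α : PF X} (Ss : FunctionalKleeneanWMonoid.S M s) (St : FunctionalKleeneanWMonoid.S M t)
  (Bα : FunctionalKleeneanWMonoid.B M α) where

  open FunctionalKleeneanWMonoid M
  open SetoidReasoning (≐-setoid X)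

  private
    w : PF X
    w = while t α s

    Sw : S w
    Sw = S-while St Bα Ss

    unfold : w ≐ ite t α (s ⨾ w) idPF
    unfold = while-unfold St Bα Ss

  while-body : D (t ⨾ α) ⨾ s ⨾ w ≐ D (t ⨾ α) ⨾ w
  while-body = begin
    D (t ⨾ α) ⨾ s ⨾ w                       ≈⟨ ⨾-assoc (D (t ⨾ α)) s w ⟩
    D (t ⨾ α) ⨾ (s ⨾ w)                     ≈⟨ ite-then St Bα (S-comp Ss Sw) S-id ⟨
    D (t ⨾ α) ⨾ ite t α (s ⨾ w) idPF        ≈⟨ ⨾-congˡ (D (t ⨾ α)) unfold ⟨
    D (t ⨾ α) ⨾ w                           ∎

  while-exit-identity : D (t ⨾ (α ′)) ⨾ w ≐ D (t ⨾ (α ′))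
  while-exit-identity = begin
    D (t ⨾ (α ′)) ⨾ w                       ≈⟨ ⨾-congˡ (D (t ⨾ (α ′))) unfold ⟩
    D (t ⨾ (α ′)) ⨾ ite t α (s ⨾ w) idPF    ≈⟨ ite-else St Bα (S-comp Ss Sw) S-id ⟩
    D (t ⨾ (α ′)) ⨾ idPF                    ≈⟨ ⨾-identityʳ (D (t ⨾ (α ′))) ⟩
    D (t ⨾ (α ′))                           ∎

  while-⨾-exit-fixed : {u : PF X} → D (t ⨾ (α ′)) ⨾ u ≐ D (t ⨾ (α ′)) → w ⨾ u ≐ w
  while-⨾-exit-fixed {u} exit-u = begin
    w ⨾ u                                   ≈⟨ ⨾-congʳ u (while-exit St Bα Ss) ⟨
    w ⨾ D (t ⨾ (α ′)) ⨾ u                   ≈⟨ ⨾-assoc w (D (t ⨾ (α ′))) u ⟩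
    w ⨾ (D (t ⨾ (α ′)) ⨾ u)                 ≈⟨ ⨾-congˡ w exit-u ⟩
    w ⨾ D (t ⨾ (α ′))                       ≈⟨ while-exit St Bα Ss ⟩
    w                                       ∎

  while-least : {u : PF X} → S u →
    D (t ⨾ α) ⨾ s ⨾ u ≐ D (t ⨾ α) ⨾ u → D (t ⨾ (α ′)) ⨾ u ≐ D (t ⨾ (α ′)) →
    w ≤ₙ u
  while-least {u} Su body-u exit-u =
    ≤ₙ-respˡ-≐ (≐-sym (while-⨾-exit-fixed exit-u)) wu≤u
    where
    wu≤u : w ⨾ u ≤ₙ u
    wu≤u = while-ind St Bα Ss Su (≤ₙ-respˡ-≐ body-u (D⨾-≤ₙ (t ⨾ α) u))

proposition4p2 : {X : Set} (M : FunctionalKleeneanWMonoid X) →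
    let open FunctionalKleeneanWMonoid M in
    ∀ {s t α} → S s → S t → B α →
      (S (while t α s)
        × (D (t ⨾ α) ⨾ s ⨾ while t α s ≐ D (t ⨾ α) ⨾ while t α s)
        × (D (t ⨾ (α ′)) ⨾ while t α s ≐ D (t ⨾ (α ′))))
      × (∀ {u} → S u →
          D (t ⨾ α) ⨾ s ⨾ u ≐ D (t ⨾ α) ⨾ u →
          D (t ⨾ (α ′)) ⨾ u ≐ D (t ⨾ (α ′)) →
          while t α s ≤ₙ u)
proposition4p2 M Ss St Bα =
  (S-while St Bα Ss , while-body , while-exit-identity) , while-least
  where
  open FunctionalKleeneanWMonoid M using (S-while)
  open WhileLoop M Ss St Bα
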